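{- Let $V$ be the polyomino consisting of the 14 tiles with centers $(1,0),(2,0),(2,1),(3,1),(3,2),(4,2),(5,2),(2,3),(3,3),(4,3),(2,4),(3,4),(4,4),(5,4)$, and let $A=(1,0)$, $B=(5,4)$, $C=(5,2)$. Let $G$ be any set of four rooks on tiles of $V$ that guards all of $V$. If $G$ has a rook on $B$ or on $C$, then $G$ has no rook on $A$; and if $G$ has a rook on $A$, then $G$ has no rook on $B$ or $C$. Moreover, no set of three rooks guards all tiles of $V$.
   Context: Tiles are unit squares identified with their centers in $\mathbb{Z}^2$. A rook on tile $p$ of a polyomino $P$ guards $p$ and, for each $e\in\{(\pm1,0),(0,\pm1)\}$, every $p+ke$ ($k\ge1$) such that $p+je$ is a tile of $P$ for all $0\le j\le k$. A set of rooks guards $P$ if every tile of $P$ is guarded by some rook. -}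

module Defs where

open import Data.Nat using (ℕ; _≤_)
open import Data.Integer using (ℤ; +_; -[1+_]; _+_; _*_)
open import Data.Product using (_×_; _,_; ∃-syntax; Σ-syntax)
open import Data.Sum using (_⊎_)
open import Data.List using (List; []; _∷_; length)
open import Data.List.Membership.Propositional using (_∈_)
open import Relation.Binary.PropositionalEquality using (_≡_)

-- A tile is identified with its center in ℤ².
Tile : Set
Tile = ℤ × ℤ

Polyomino : Set
Polyomino = List Tile

_⊕_ : Tile → Tile → Tile
(a , b) ⊕ (c , d) = (a + c , b + d)

_·_ : ℕ → Tile → Tile
k · (a , b) = ((+ k) * a , (+ k) * b)

data Dir : Tile → Set where
  right : Dir (+ 1 , + 0)
  left  : Dir (-[1+ 0 ] , + 0)
  up    : Dir (+ 0 , + 1)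
  down  : Dir (+ 0 , -[1+ 0 ])

Guards : Polyomino → Tile → Tile → Set
Guards P p q =
  ∃[ e ] ∃[ k ] (Dir e × (q ≡ p ⊕ (k · e)) × (∀ j → j ≤ k → (p ⊕ (j · e)) ∈ P))

GuardsAll : Polyomino → List Tile → Set
GuardsAll P G = ∀ q → q ∈ P → ∃[ r ] (r ∈ G × Guards P r q)

tile : ℕ → ℕ → Tile
tile x y = (+ x , + y)

V : Polyomino
V = tile 1 0 ∷ tile 2 0 ∷ tile 2 1 ∷ tile 3 1 ∷ tile 3 2 ∷ tile 4 2 ∷ tile 5 2
  ∷ tile 2 3 ∷ tile 3 3 ∷ tile 4 3 ∷ tile 2 4 ∷ tile 3 4 ∷ tile 4 4 ∷ tile 5 4 ∷ []

A B C : Tile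
A = tile 1 0
B = tile 5 4
C = tile 5 2

-- A rook sees only a segment of its row and of its column, so its view is computable.  If k rooks
-- guard a set of tiles, then some rook sees the first tile; discarding that rook and everything it
-- sees leaves the rest guarded by k - 1 rooks.  This turns guarding into a finite search that only
-- branches over the rooks seeing the first unguarded tile, and running it on V shows that three rooks
-- never suffice, nor do two rooks added to A and B or to A and C.
module Submission where

open import Defs
open import Data.Bool using (Bool; true; false; T)
open import Data.Bool.ListAction using (any)
open import Data.Empty using (⊥-elim)
open import Data.Integer using (ℤ; +_; -[1+_]; _+_; _*_)
import Data.Integer as ℤ
import Data.Integer.Properties as ℤ
open import Data.Nat using (ℕ; zero; suc; pred; z≤n; s≤s; _<_; _≤_; _≤?_)
open import Data.Nat.Properties using (≰⇒>)
open import Data.Product using (_×_; _,_; ∃-syntax)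
open import Data.Product.Properties using (≡-dec)
open import Data.Sum using (_⊎_; inj₁; inj₂)
open import Data.List using (List; []; _∷_; length; filter; concatMap)
open import Data.List.Properties using (length-removeAt)
open import Data.List.Relation.Unary.All using (All)
import Data.List.Relation.Unary.All as All
open import Data.List.Relation.Unary.All.Properties using (all-filter; filter⁺; ─⁺)
open import Data.List.Relation.Unary.Any using (Any; here; there; index; _─_)
open import Data.List.Relation.Unary.Any.Properties using (any⁺)
open import Data.List.Relation.Unary.Unique.Propositional using (Unique)
open import Data.List.Membership.Propositional using (_∈_; _∉_; find; lose)
open import Data.List.Membership.Propositional.Properties using (∈-concatMap⁺; ∈-filter⁺)
import Data.List.Membership.DecPropositional as DecMembership
open import Relation.Nullary using (¬_; Dec; yes; no; ¬?)
open import Relation.Nullary.Decidable using (toWitness)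
open import Relation.Binary.PropositionalEquality
  using (_≡_; _≢_; refl; sym; trans; cong; cong₂; subst; module ≡-Reasoning)

open DecMembership (≡-dec ℤ._≟_ ℤ._≟_) using (_∈?_)

⊕-zero· : (p e : Tile) → p ⊕ (0 · e) ≡ p
⊕-zero· (a , b) (c , d) = cong₂ _,_ (ℤ.+-identityʳ a) (ℤ.+-identityʳ b)

⊕-suc· : (p e : Tile) (j : ℕ) → p ⊕ (suc j · e) ≡ (p ⊕ e) ⊕ (j · e)
⊕-suc· (a , b) (c , d) j = cong₂ _,_ (+-suc* a c) (+-suc* b d)
  where
  open ≡-Reasoning
  +-suc* : (a c : ℤ) → a + + suc j * c ≡ (a + c) + + j * c
  +-suc* a c = begin
    a + + suc j * c          ≡⟨ cong (_+_ a) (ℤ.*-distribʳ-+ c (+ 1) (+ j)) ⟩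
    a + (+ 1 * c + + j * c)  ≡⟨ cong (λ t → a + (t + + j * c)) (ℤ.*-identityˡ c) ⟩
    a + (c + + j * c)        ≡⟨ sym (ℤ.+-assoc a c (+ j * c)) ⟩
    (a + c) + + j * c        ∎

Clear : Polyomino → Tile → Tile → ℕ → Set
Clear P p e k = ∀ j → j ≤ k → p ⊕ (j · e) ∈ P

Clear-start : ∀ {P p e k} → Clear P p e k → p ∈ P
Clear-start {P} {p} {e} clear = subst (_∈ P) (⊕-zero· p e) (clear 0 z≤n)

Clear-tail : ∀ {P p e k} → Clear P p e (suc k) → Clear P (p ⊕ e) e k
Clear-tail {P} {p} {e} clear j j≤k = subst (_∈ P) (⊕-suc· p e j) (clear (suc j) (s≤s j≤k))

Clear⇒<exit : ∀ {P p e n} k → p ⊕ (n · e) ∉ P → Clear P p e k → k < n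
Clear⇒<exit {n = n} k exit clear with n ≤? k
... | yes n≤k = ⊥-elim (exit (clear n n≤k))
... | no  n≰k = ≰⇒> n≰k

ray : Polyomino → ℕ → Tile → Tile → List Tile
ray P zero    p e = []
ray P (suc n) p e with p ∈? P
... | yes _ = p ∷ ray P n (p ⊕ e) e
... | no  _ = []

∈-ray : ∀ P n p e k → k < n → Clear P p e k → p ⊕ (k · e) ∈ ray P n p e
∈-ray P (suc n) p e k k<n clear with p ∈? P
... | no  p∉P = ⊥-elim (p∉P (Clear-start {P} {p} {e} clear))
∈-ray P (suc n) p e zero    _         clear | yes _ = here (⊕-zero· p e)
∈-ray P (suc n) p e (suc k) (s≤s k<n) clear | yes _ =
  there (subst (_∈ ray P n (p ⊕ e) e) (sym (⊕-suc· p e k)) (∈-ray P n (p ⊕ e) e k k<n (Clear-tail {P} {p} {e} clear)))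

directions : List Tile
directions = (+ 1 , + 0) ∷ (-[1+ 0 ] , + 0) ∷ (+ 0 , + 1) ∷ (+ 0 , -[1+ 0 ]) ∷ []

Dir⇒∈directions : ∀ {e} → Dir e → e ∈ directions
Dir⇒∈directions right = here refl
Dir⇒∈directions left  = there (here refl)
Dir⇒∈directions up    = there (there (here refl))
Dir⇒∈directions down  = there (there (there (here refl)))

sight : Polyomino → ℕ → Tile → List Tile
sight P n r = concatMap (ray P n r) directions

guards⇒∈sight : ∀ {P n r q} → (∀ {e} → Dir e → r ⊕ (n · e) ∉ P) → Guards P r q → q ∈ sight P n r
guards⇒∈sight {P} {n} {r} exits (e , k , dir , refl , clear) =
  ∈-concatMap⁺ (ray P n r)
    (lose (Dir⇒∈directions dir) (∈-ray P n r e k (Clear⇒<exit {P} {r} {e} {n} k (exits dir) clear) clear))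

Any-─ : ∀ {A : Set} {P : A → Set} {x xs} (x∈xs : x ∈ xs) → Any P xs → ¬ P x → Any P (xs ─ x∈xs)
Any-─ (here refl) (here Px)   ¬Px = ⊥-elim (¬Px Px)
Any-─ (here refl) (there Pxs) _   = Pxs
Any-─ (there x∈xs) (here Py)  _   = here Py
Any-─ (there x∈xs) (there Pxs) ¬Px = there (Any-─ x∈xs Pxs ¬Px)

length-─ : ∀ {A : Set} {P : A → Set} {xs k} (p : Any P xs) → length xs ≡ suc k → length (xs ─ p) ≡ k
length-─ {xs = xs} p |xs| = trans (length-removeAt xs (index p)) (cong pred |xs|)

module Covering (Rooks : List Tile) (visible : Tile → List Tile) where

  Covers : List Tile → List Tile → Set
  Covers G qs = All (λ q → Any (λ r → q ∈ visible r) G) qs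

  unseen? : ∀ r q → Dec (q ∉ visible r)
  unseen? r q = ¬? (q ∈? visible r)

  unseenBy : Tile → List Tile → List Tile
  unseenBy r = filter (unseen? r)

  Covers-─ : ∀ {G qs r} → Covers G qs → (r∈G : r ∈ G) → Covers (G ─ r∈G) (unseenBy r qs)
  Covers-─ {qs = qs} {r} cov r∈G =
    All.zipWith (λ (seen , unseen) → Any-─ r∈G seen unseen)
      (filter⁺ (unseen? r) cov , all-filter (unseen? r) qs)

  coverable : ℕ → List Tile → Bool
  coverable _       []       = true
  coverable zero    (_ ∷ _)  = false
  coverable (suc k) (t ∷ qs) =
    any (λ r → coverable k (unseenBy r qs)) (filter (λ r → t ∈? visible r) Rooks)

  Covers⇒coverable : ∀ k G qs → length G ≡ k → All (_∈ Rooks) G → Covers G qs → T (coverable k qs)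
  Covers⇒coverable _       _  []       _   _     _                  = _
  Covers⇒coverable zero    [] (_ ∷ _)  _   _     (() All.∷ _)
  Covers⇒coverable (suc k) G  (t ∷ qs) |G| rooks (sees-t All.∷ cov) with find sees-t
  ... | r , r∈G , t∈view =
    any⁺ _ (lose (∈-filter⁺ (λ r → t ∈? visible r) (All.lookup rooks r∈G) t∈view)
      (Covers⇒coverable k (G ─ r∈G) (unseenBy r qs) (length-─ r∈G |G|) (─⁺ r∈G rooks) (Covers-─ cov r∈G)))

-- V lies in a 5 × 5 box, so five steps in any direction leave it.
V-exits-in-5 : ∀ {r e} → r ∈ V → Dir e → r ⊕ (5 · e) ∉ V
V-exits-in-5 r∈V dir = All.lookup (All.lookup table r∈V) (Dir⇒∈directions dir)
  where
  table : All (λ r → All (λ e → r ⊕ (5 · e) ∉ V) directions) V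
  table = toWitness {a? = All.all? (λ r → All.all? (λ e → ¬? (r ⊕ (5 · e) ∈? V)) directions) V} _

open Covering V (sight V 5)

GuardsAll⇒Covers : ∀ {G} → All (_∈ V) G → GuardsAll V G → Covers G V
GuardsAll⇒Covers {G} rooks guarded = All.tabulate λ {q} q∈V → seen (guarded q q∈V)
  where
  seen : ∀ {q} → ∃[ r ] (r ∈ G × Guards V r q) → Any (λ r → q ∈ sight V 5 r) G
  seen (r , r∈G , guards) = lose r∈G (guards⇒∈sight {V} {5} {r} (V-exits-in-5 (All.lookup rooks r∈G)) guards)

three-rooks-never-guard-V : ∀ {G} → length G ≡ 3 → All (_∈ V) G → ¬ GuardsAll V G
three-rooks-never-guard-V {G} |G| rooks guarded =
  subst T {y = false} refl (Covers⇒coverable 3 G V |G| rooks (GuardsAll⇒Covers rooks guarded))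

four-rooks-with-A-exclude : ∀ {X G} → X ≢ A → coverable 2 (unseenBy X (unseenBy A V)) ≡ false →
  length G ≡ 4 → All (_∈ V) G → GuardsAll V G → A ∈ G → X ∉ G
four-rooks-with-A-exclude {X} {G} X≢A uncoverable |G| rooks guarded A∈G X∈G =
  subst T uncoverable
    (Covers⇒coverable 2 (G ─ A∈G ─ X∈G-A) _
      (length-─ X∈G-A (length-─ A∈G |G|))
      (─⁺ X∈G-A (─⁺ A∈G rooks))
      (Covers-─ (Covers-─ (GuardsAll⇒Covers rooks guarded) A∈G) X∈G-A))
  where
  X∈G-A : X ∈ (G ─ A∈G)
  X∈G-A = Any-─ A∈G X∈G X≢A

four-rooks-with-A-exclude-B-C : ∀ {G} → length G ≡ 4 → All (_∈ V) G → GuardsAll V G →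
  A ∈ G → ¬ (B ∈ G ⊎ C ∈ G)
four-rooks-with-A-exclude-B-C |G| rooks guarded A∈G (inj₁ B∈G) =
  four-rooks-with-A-exclude (λ ()) refl |G| rooks guarded A∈G B∈G
four-rooks-with-A-exclude-B-C |G| rooks guarded A∈G (inj₂ C∈G) =
  four-rooks-with-A-exclude (λ ()) refl |G| rooks guarded A∈G C∈G

-- The distinctness hypotheses are unused: the claims hold even for lists of rooks with repetitions.
corollary7 : ((G : List Tile) → Unique G → length G ≡ 4 → All (_∈ V) G → GuardsAll V G →
    ((B ∈ G ⊎ C ∈ G) → A ∉ G) × (A ∈ G → ¬ (B ∈ G ⊎ C ∈ G)))
    × ((G : List Tile) → Unique G → length G ≡ 3 → All (_∈ V) G → ¬ GuardsAll V G)
corollary7 =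
  (λ G _ |G| rooks guarded →
      (λ B∨C A∈G → four-rooks-with-A-exclude-B-C |G| rooks guarded A∈G B∨C)
    , four-rooks-with-A-exclude-B-C |G| rooks guarded)
  , λ G _ → three-rooks-never-guard-V
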